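{- Let $Y$ be a finite set of variables, $X \subseteq Y$, and $Z,P\subseteq\mathbb{Q}[Y]$ finite sets of polynomials. Then \[ \mathrm{alg.cone}_X(\mathit{project}_X(Z,P)) = \mathrm{alg.cone}_Y(Z,P) \cap \mathbb{Q}[X]. \]
   Context: For finite $Z,P \subseteq \mathbb{Q}[V]$, $\mathrm{alg.cone}_V(Z,P) = \langle Z\rangle_V + \mathrm{cone}(P)$, where $\langle Z\rangle_V$ is the ideal of $\mathbb{Q}[V]$ generated by $Z$ and $\mathrm{cone}(P)$ is the set of non-negative rational combinations of elements of $P$. Fix a monomial ordering $\preceq$. Every monomial $m$ over $Y$ factors uniquely as $m_X m_{\overline X}$ with $m_X$ a monomial over $X$ and $m_{\overline X}$ over $Y\setminus X$; the elimination ordering $\preceq_X$ is defined by $m \preceq_X n$ iff $m_{\overline X} \prec n_{\overline X}$, or $m_{\overline X}=n_{\overline X}$ and $m_X\preceq n_X$. For a finite set of polynomials $S$ and a set of monomials $N$, $\mathrm{proj}(S,N)$ denotes a finite set of polynomials (e.g. obtained by Fourier–Motzkin elimination of the monomials not in $N$) with $\mathrm{cone}(\mathrm{proj}(S,N)) = \mathrm{cone}(S) \cap \mathrm{span}_{\mathbb{Q}}(N)$. Let $[X]$ be the set of monomials over $X$. Define $\mathit{project}_X(Z,P) = \langle G \cap \mathbb{Q}[X],\ \mathrm{proj}(\{\mathbf{red}_G(p): p\in P\}, [X])\rangle$, where $G$ is a Gröbner basis of the ideal of $\mathbb{Q}[Y]$ generated by $Z$ with respect to $\preceq_X$ and $\mathbf{red}_G$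 is the normal form modulo $G$. -}

module Defs where

open import Data.Nat as ℕ using (ℕ)
open import Data.Fin using (Fin)
open import Data.Fin.Subset using (Subset; Side; inside; outside; _∈_; _∉_)
open import Data.Vec using (Vec; lookup; zipWith; replicate)
open import Data.Vec.Properties using (≡-dec)
open import Data.Rational using (ℚ; 0ℚ; 1ℚ; _+_; _*_; -_; _≤_)
open import Data.List using (List; []; _∷_; _++_; map; concatMap; foldr)
open import Data.List.Relation.Unary.All using (All)
import Data.List.Membership.Propositional as L
open import Data.Product using (Σ; ∃; _×_; _,_; proj₁; proj₂)
open import Data.Sum using (_⊎_)
open import Relation.Binary.PropositionalEquality using (_≡_; _≢_)
open import Relation.Binary.Structures using (IsTotalOrder)
open import Relation.Nullary using (yes; no)
open import Data.Empty using (⊥)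

Mono : ℕ → Set
Mono n = Vec ℕ n

one : ∀ {n} → Mono n
one = replicate _ 0

_·ₘ_ : ∀ {n} → Mono n → Mono n → Mono n
_·ₘ_ = zipWith ℕ._+_

_∣ₘ_ : ∀ {n} → Mono n → Mono n → Set
_∣ₘ_ {n} m m' = ∀ (i : Fin n) → lookup m i ℕ.≤ lookup m' i

keep : Side → ℕ → ℕ
keep inside  e = e
keep outside e = 0

drop : Side → ℕ → ℕ
drop inside  e = 0
drop outside e = e

restrict : ∀ {n} → Subset n → Mono n → Mono n
restrict X m = zipWith keep X m

corestrict : ∀ {n} → Subset n → Mono n → Mono n
corestrict X m = zipWith drop X m

-- Polynomials in ℚ[Y], as finite lists of terms (coefficient, monomial);
-- equality is equality of all coefficients.

Poly : ℕ → Set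
Poly n = List (ℚ × Mono n)

coeff : ∀ {n} → Poly n → Mono n → ℚ
coeff [] m = 0ℚ
coeff ((c , m') ∷ p) m with ≡-dec ℕ._≟_ m' m
... | yes _ = c + coeff p m
... | no  _ = coeff p m

_≈_ : ∀ {n} → Poly n → Poly n → Set
p ≈ q = ∀ m → coeff p m ≡ coeff q m

0ₚ : ∀ {n} → Poly n
0ₚ = []

_+ₚ_ : ∀ {n} → Poly n → Poly n → Poly n
_+ₚ_ = _++_

-ₚ_ : ∀ {n} → Poly n → Poly n
-ₚ_ = map (λ t → (- proj₁ t , proj₂ t))

_-ₚ_ : ∀ {n} → Poly n → Poly n → Poly n
p -ₚ q = p +ₚ (-ₚ q)

_*ₚ_ : ∀ {n} → Poly n → Poly n → Poly n
p *ₚ q = concatMap (λ s → map (λ t → (proj₁ s * proj₁ t , proj₂ s ·ₘ proj₂ t)) q) p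

_·ₚ_ : ∀ {n} → ℚ → Poly n → Poly n
c ·ₚ p = map (λ t → (c * proj₁ t , proj₂ t)) p

sumₚ : ∀ {n} → List (Poly n) → Poly n
sumₚ = foldr _+ₚ_ 0ₚ

InSupp : ∀ {n} → Poly n → Mono n → Set
InSupp p m = coeff p m ≢ 0ℚ

InQ : ∀ {n} → Subset n → Poly n → Set
InQ {n} V p = ∀ m → InSupp p m → ∀ (i : Fin n) → i ∉ V → lookup m i ≡ 0

InIdeal : ∀ {n} → Subset n → List (Poly n) → Poly n → Set
InIdeal V Z f =
  Σ (List (Poly _ × Poly _)) λ cs →
    All (λ c → InQ V (proj₁ c)) cs ×
    All (λ c → proj₂ c L.∈ Z) cs ×
    f ≈ sumₚ (map (λ c → proj₁ c *ₚ proj₂ c) cs)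

InCone : ∀ {n} → List (Poly n) → Poly n → Set
InCone P f =
  Σ (List (ℚ × Poly _)) λ cs →
    All (λ c → 0ℚ ≤ proj₁ c) cs ×
    All (λ c → proj₂ c L.∈ P) cs ×
    f ≈ sumₚ (map (λ c → proj₁ c ·ₚ proj₂ c) cs)

InAlgCone : ∀ {n} → Subset n → List (Poly n) → List (Poly n) → Poly n → Set
InAlgCone V Z P f =
  Σ (Poly _) λ a → Σ (Poly _) λ b →
    InIdeal V Z a × InCone P b × f ≈ (a +ₚ b)

record MonomialOrder (n : ℕ) : Set₁ where
  field
    _≼_      : Mono n → Mono n → Set
    isTotal  : IsTotalOrder _≡_ _≼_
    mult     : ∀ a b c → a ≼ b → (a ·ₘ c) ≼ (b ·ₘ c)
    oneLeast : ∀ m → one ≼ m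

  _≺_ : Mono n → Mono n → Set
  a ≺ b = a ≼ b × a ≢ b

_≼[_]_ : ∀ {n} → Mono n → (MonomialOrder n × Subset n) → Mono n → Set
m ≼[ (ord , X) ] m' =
  (corestrict X m ≺ corestrict X m')
  ⊎ (corestrict X m ≡ corestrict X m' × restrict X m ≼ restrict X m')
  where open MonomialOrder ord

Rel≼ : ℕ → Set₁
Rel≼ n = Mono n → Mono n → Set

elimRel : ∀ {n} → MonomialOrder n → Subset n → Rel≼ n
elimRel ord X m m' = m ≼[ (ord , X) ] m'

IsLM : ∀ {n} → Rel≼ n → Poly n → Mono n → Set
IsLM _≼_ f m = InSupp f m × (∀ m' → InSupp f m' → m' ≼ m)

IsGroebner : ∀ {n} → Rel≼ n → List (Poly n) → List (Poly n) → Set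
IsGroebner {n} _≼_ Z G =
  All (InIdeal Data.Fin.Subset.⊤ Z) G ×
  (∀ f → InIdeal Data.Fin.Subset.⊤ Z f → ¬≈0 f →
     Σ (Poly n) λ g → g L.∈ G × Σ (Mono n) λ lg → Σ (Mono n) λ lf →
       IsLM _≼_ g lg × IsLM _≼_ f lf × lg ∣ₘ lf)
  where
  ¬≈0 : Poly n → Set
  ¬≈0 f = ∃ λ m → InSupp f m

IsNormalForm : ∀ {n} → Rel≼ n → List (Poly n) → Poly n → Poly n → Set
IsNormalForm {n} _≼_ G p r =
  InIdeal Data.Fin.Subset.⊤ G (p -ₚ r) ×
  (∀ m → InSupp r m → ∀ g → g L.∈ G → ∀ lg → IsLM _≼_ g lg → lg ∣ₘ m → ⊥)

-- Let h ∈ ⟨Z⟩ and let s be a nonnegative combination of the normal forms R.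
-- If h + s ∈ ℚ[X] then h ∈ ℚ[X]: the ≼_X-leading monomial of h is divisible by
-- the leading monomial of some g ∈ G, so it does not occur in s, survives in
-- h + s, and hence lies in [X]; since ≼_X eliminates the variables outside X,
-- all monomials of h then lie in [X]. Because every p ∈ P differs from red_G(p)
-- by an element of ⟨Z⟩, each f ∈ alg.cone_Y(Z,P) ∩ ℚ[X] thus splits as h + s
-- with s ∈ cone(R) ∩ ℚ[X] = cone(Q) and h ∈ ⟨Z⟩ ∩ ℚ[X], and division by G
-- (terminating by Dickson's lemma) gives ⟨Z⟩ ∩ ℚ[X] = ⟨G ∩ ℚ[X]⟩_X.

module Submission where

open import Defs
open import Data.Nat using (ℕ)
open import Data.Fin.Subset using (Subset; ⊤)
open import Data.List using (List)
open import Data.List.Membership.Propositional using (_∈_)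
open import Data.List.Relation.Binary.Pointwise using (Pointwise; _∷_)
open import Data.Product using (_×_)
open import Function.Bundles using (_⇔_)

open import Data.Nat as ℕ using (suc; _≤_; _<_; s≤s)
import Data.Nat.Properties as ℕ
open import Data.Fin using (Fin; toℕ; fromℕ<)
open import Data.Fin.Properties using (all?; ¬∀⟶∃¬; toℕ-fromℕ<)
open import Data.Fin.Subset using (inside; outside; _∉_)
open import Data.Fin.Subset.Properties using (_∈?_; ∈⊤)
open import Data.Vec as Vec using (lookup; zipWith)
import Data.Vec.Properties as Vec
open import Data.Vec.Relation.Binary.Pointwise.Extensional using (ext; Pointwise-≡⇒≡)
open import Data.List as List using ([]; _∷_; _++_; map; filter; length; allFin)
import Data.List.Properties as List
open import Data.List.Membership.Propositional.Properties using (∈-allFin; ∈-filter⁺)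
open import Data.List.Relation.Unary.Any as Any using (Any; here; there)
import Data.List.Extrema as Extrema
open import Data.List.Relation.Unary.All as All using (All; []; _∷_)
import Data.List.Relation.Unary.All.Properties as All
open import Data.Product using (Σ; _,_; proj₁; proj₂)
open import Data.Sum using (_⊎_; inj₁; inj₂)
open import Data.Empty using (⊥; ⊥-elim)
open import Data.Rational as ℚ using (ℚ; 0ℚ; 1ℚ; _+_; _*_; -_; _-_)
import Data.Rational.Properties as ℚ
open import Data.Rational.Solver using (module +-*-Solver)
open import Function using (_∘_; case_of_)
open import Function.Bundles using (Equivalence; mk⇔)
open import Induction.WellFounded using (Acc; acc; WellFounded)
open import Relation.Binary using (Rel; Transitive; IsEquivalence; Setoid; TotalOrder)
open import Relation.Binary.Structures using (IsTotalOrder)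
open import Relation.Binary.PropositionalEquality
open import Relation.Nullary using (¬_; Dec; yes; no; ¬?)
open import Relation.Nullary.Decidable using (_→-dec_)
open import Relation.Unary using (Pred)
open import Level using (0ℓ)
import Relation.Binary.Reasoning.Setoid as SetoidReasoning

module ≡ = ≡-Reasoning

-- Monomials

module _ {n : ℕ} where

  ≡-pointwise : {u v : Mono n} → (∀ i → lookup u i ≡ lookup v i) → u ≡ v
  ≡-pointwise h = Pointwise-≡⇒≡ (ext h)

  lookup-·ₘ : ∀ (a b : Mono n) i → lookup (a ·ₘ b) i ≡ lookup a i ℕ.+ lookup b i
  lookup-·ₘ a b i = Vec.lookup-zipWith ℕ._+_ i a b

  lookup-one : ∀ i → lookup (one {n}) i ≡ 0
  lookup-one i = Vec.lookup-replicate i 0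

  ·ₘ-comm : ∀ (a b : Mono n) → a ·ₘ b ≡ b ·ₘ a
  ·ₘ-comm = Vec.zipWith-comm ℕ.+-comm

  ·ₘ-assoc : ∀ (a b c : Mono n) → (a ·ₘ b) ·ₘ c ≡ a ·ₘ (b ·ₘ c)
  ·ₘ-assoc = Vec.zipWith-assoc ℕ.+-assoc

  ·ₘ-identityˡ : ∀ (a : Mono n) → one ·ₘ a ≡ a
  ·ₘ-identityˡ = Vec.zipWith-identityˡ ℕ.+-identityˡ

  ·ₘ-cancelˡ : ∀ (d a b : Mono n) → d ·ₘ a ≡ d ·ₘ b → a ≡ b
  ·ₘ-cancelˡ d a b eq = ≡-pointwise λ i → ℕ.+-cancelˡ-≡ (lookup d i) _ _ (begin
    lookup d i ℕ.+ lookup a i ≡⟨ lookup-·ₘ d a i ⟨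
    lookup (d ·ₘ a) i         ≡⟨ cong (λ v → lookup v i) eq ⟩
    lookup (d ·ₘ b) i         ≡⟨ lookup-·ₘ d b i ⟩
    lookup d i ℕ.+ lookup b i ∎)
    where open ≡-Reasoning

  _∸ₘ_ : Mono n → Mono n → Mono n
  _∸ₘ_ = zipWith ℕ._∸_

  ∣ₘ-·ₘ : ∀ (d a : Mono n) → d ∣ₘ (d ·ₘ a)
  ∣ₘ-·ₘ d a i = subst (lookup d i ≤_) (sym (lookup-·ₘ d a i)) (ℕ.m≤m+n _ _)

  ·ₘ-∸ₘ : ∀ {d m : Mono n} → d ∣ₘ m → d ·ₘ (m ∸ₘ d) ≡ m
  ·ₘ-∸ₘ {d} {m} d∣m = ≡-pointwise λ i → begin
    lookup (d ·ₘ (m ∸ₘ d)) i                 ≡⟨ lookup-·ₘ d _ i ⟩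
    lookup d i ℕ.+ lookup (m ∸ₘ d) i         ≡⟨ cong (lookup d i ℕ.+_) (Vec.lookup-zipWith ℕ._∸_ i m d) ⟩
    lookup d i ℕ.+ (lookup m i ℕ.∸ lookup d i) ≡⟨ ℕ.m+[n∸m]≡n (d∣m i) ⟩
    lookup m i                               ∎
    where open ≡-Reasoning

  ∸ₘ-∣ₘ : ∀ (d m : Mono n) → (m ∸ₘ d) ∣ₘ m
  ∸ₘ-∣ₘ d m i = subst (_≤ lookup m i) (sym (Vec.lookup-zipWith ℕ._∸_ i m d)) (ℕ.m∸n≤m (lookup m i) (lookup d i))

  _∣ₘ?_ : ∀ (a b : Mono n) → Dec (a ∣ₘ b)
  a ∣ₘ? b = all? (λ i → lookup a i ℕ.≤? lookup b i)

-- Dickson's lemma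

module RestrictedAccessibility {A : Set} (_⊏_ : Rel A 0ℓ) (⊏-trans : Transitive _⊏_) where

  Within : Pred A 0ℓ → Rel A 0ℓ
  Within S y x = S y × y ⊏ x

  Acc-⊆ : ∀ {S T x} → (∀ {y} → y ⊏ x → T y → S y) → Acc (Within S) x → Acc (Within T) x
  Acc-⊆ T⊆S (acc rs) = acc λ { (ty , y⊏x) →
    Acc-⊆ (λ z⊏y → T⊆S (⊏-trans z⊏y y⊏x)) (rs (T⊆S y⊏x ty , y⊏x)) }

  Acc-all : ∀ {S x} → (∀ {z} → S z → Acc (Within S) z) → Acc (Within S) x
  Acc-all h = acc λ { (sy , _) → h sy }

  Acc-downward : ∀ {S x y} → Acc (Within S) x → y ⊏ x → Acc (Within S) y
  Acc-downward (acc rs) y⊏x = acc λ { (sz , z⊏y) → rs (sz , ⊏-trans z⊏y y⊏x) }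

  Acc-∪ : ∀ {S T x} → Acc (Within S) x → Acc (Within T) x →
          Acc (Within (λ y → S y ⊎ T y)) x
  Acc-∪ {S} {T} {x} (acc rsS) accT = go accT (λ z⊏y → z⊏y)
    where
    go : ∀ {y} → Acc (Within T) y → (∀ {z} → z ⊏ y → z ⊏ x) →
         Acc (Within (λ y → S y ⊎ T y)) y
    go (acc rsT) below = acc λ
      { (inj₁ sz , z⊏y) → Acc-∪ (rsS (sz , below z⊏y)) (Acc-downward accT (below z⊏y))
      ; (inj₂ tz , z⊏y) → go (rsT (tz , z⊏y)) (λ w⊏z → below (⊏-trans w⊏z z⊏y)) }

  Acc-Any : ∀ {I : Set} {S : I → Pred A 0ℓ} {x} (is : List I) →
            (∀ {i} → i ∈ is → Acc (Within (S i)) x) →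
            Acc (Within (λ y → Any (λ i → S i y) is)) x
  Acc-Any [] _ = acc λ { (() , _) }
  Acc-Any {S = S} {x} (i ∷ is) h = Acc-⊆ split (Acc-∪ (h (here refl)) (Acc-Any is (h ∘ there)))
    where
    split : ∀ {y} → y ⊏ x → Any (λ j → S j y) (i ∷ is) → S i y ⊎ Any (λ j → S j y) is
    split _ (here s) = inj₁ s
    split _ (there s) = inj₂ s

  Acc-universal : ∀ {S x} → (∀ y → S y) → Acc (Within S) x → Acc _⊏_ x
  Acc-universal all (acc rs) = acc λ y⊏x → Acc-universal all (rs (all _ , y⊏x))

module Dickson {n : ℕ} (_⊏_ : Rel (Mono n) 0ℓ) (⊏-trans : Transitive _⊏_)
               (⊏⇒∤ : ∀ {x y} → y ⊏ x → ¬ (x ∣ₘ y)) where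

  open RestrictedAccessibility _⊏_ ⊏-trans

  Slice : List (Fin n) → Mono n → Pred (Mono n) 0ℓ
  Slice js b y = ∀ i → ¬ (i ∈ js) → lookup y i ≡ lookup b i

  some-free-coordinate-drops : ∀ {js b x y} → Slice js b x → Slice js b y → y ⊏ x →
                               Any (λ j → lookup y j < lookup x j) js
  some-free-coordinate-drops {js} {b} {x} {y} sx sy y⊏x
    with ¬∀⟶∃¬ n _ (λ i → lookup x i ℕ.≤? lookup y i) (⊏⇒∤ y⊏x)
  ... | j , x≰y with Any.any? (j Data.Fin.≟_) js
  ...   | yes j∈js = Any.map (λ { refl → ℕ.≰⇒> x≰y }) j∈js
  ...   | no  j∉js = ⊥-elim (x≰y (ℕ.≤-reflexive (trans (sx j j∉js) (sym (sy j j∉js)))))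

  -- Below x some free coordinate drops, so y lies on one of finitely many
  -- hyperplanes, each a slice with one free coordinate fewer.
  slice-accessible : ∀ k js b → length js < k → ∀ {x} → Slice js b x → Acc (Within (Slice js b)) x
  slice-accessible (suc k) js b |js|≤k {x} sx = Acc-⊆ into
    (Acc-Any js λ {j} j∈js → Acc-Any (allFin (lookup x j))
      λ {c} _ → Acc-⊆ (hyperplane⊆slice j c)
        (Acc-all (slice-accessible k (others j) (b Vec.[ j ]≔ toℕ c)
          (ℕ.<-≤-trans (List.filter-notAll (λ i → ¬? (i Data.Fin.≟ j)) js
                          (Any.map (λ j≡i i≢j → i≢j (sym j≡i)) j∈js))
                       (ℕ.≤-pred |js|≤k)))))
    where
    others : Fin n → List (Fin n)
    others j = filter (λ i → ¬? (i Data.Fin.≟ j)) js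

    Hyperplane : Fin n → ℕ → Pred (Mono n) 0ℓ
    Hyperplane j c y = lookup y j ≡ c × Slice js b y

    hyperplane⊆slice : ∀ j (c : Fin (lookup x j)) {y} → y ⊏ x →
                       Hyperplane j (toℕ c) y → Slice (others j) (b Vec.[ j ]≔ toℕ c) y
    hyperplane⊆slice j c _ (yj≡c , sy) i i∉ with i Data.Fin.≟ j
    ... | yes refl = trans yj≡c (sym (Vec.lookup∘update i b _))
    ... | no i≢j = trans (sy i (i∉ ∘ λ i∈js → ∈-filter⁺ (λ i → ¬? (i Data.Fin.≟ j)) i∈js i≢j))
                         (sym (Vec.lookup∘update′ i≢j b _))

    into : ∀ {y} → y ⊏ x → Slice js b y →
           Any (λ j → Any (λ c → Hyperplane j (toℕ c) y) (allFin (lookup x j))) js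
    into y⊏x sy = Any.map (λ {j} yj<xj → Any.map (λ { refl → sym (toℕ-fromℕ< yj<xj) , sy })
                                           (∈-allFin (fromℕ< yj<xj)))
                          (some-free-coordinate-drops {b = b} sx sy y⊏x)

  wellFounded : WellFounded _⊏_
  wellFounded x = Acc-universal (λ y i i∉ → ⊥-elim (i∉ (∈-allFin i)))
    (slice-accessible (suc n) (allFin n) x
      (s≤s (ℕ.≤-reflexive (List.length-tabulate (λ i → i))))
      (λ i i∉ → ⊥-elim (i∉ (∈-allFin i))))

-- Monomial orders

module MonomialOrderProperties {n : ℕ} (ord : MonomialOrder n) where

  open MonomialOrder ord public
  open IsTotalOrder isTotal public using () renaming (trans to ≼-trans; antisym to ≼-antisym)

  ≺-≼-trans : ∀ {a b c} → a ≺ b → b ≼ c → a ≺ c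
  ≺-≼-trans (a≼b , a≢b) b≼c = ≼-trans a≼b b≼c , λ { refl → a≢b (≼-antisym a≼b b≼c) }

  ≺-trans : Transitive _≺_
  ≺-trans a≺b (b≼c , _) = ≺-≼-trans a≺b b≼c

  ≺-irrefl : ∀ {a} → ¬ (a ≺ a)
  ≺-irrefl (_ , a≢a) = a≢a refl

  ·ₘ-monoʳ-≼ : ∀ c {a b} → a ≼ b → (c ·ₘ a) ≼ (c ·ₘ b)
  ·ₘ-monoʳ-≼ c {a} {b} a≼b = subst₂ _≼_ (·ₘ-comm a c) (·ₘ-comm b c) (mult a b c a≼b)

  ∣ₘ⇒≼ : ∀ {a b} → a ∣ₘ b → a ≼ b
  ∣ₘ⇒≼ {a} {b} a∣b = subst₂ _≼_ (·ₘ-identityˡ a) (trans (·ₘ-comm _ a) (·ₘ-∸ₘ a∣b))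
    (mult one (b ∸ₘ a) a (oneLeast _))

  ≺⇒∤ : ∀ {a b} → b ≺ a → ¬ (a ∣ₘ b)
  ≺⇒∤ (b≼a , b≢a) a∣b = b≢a (≼-antisym b≼a (∣ₘ⇒≼ a∣b))

  ≺-wellFounded : WellFounded _≺_
  ≺-wellFounded = Dickson.wellFounded _≺_ ≺-trans ≺⇒∤

module _ {n : ℕ} where

  _∈[_] : Mono n → Subset n → Set
  m ∈[ X ] = ∀ i → i ∉ X → lookup m i ≡ 0

  opaque
    ∈[]? : ∀ m X → Dec (m ∈[ X ])
    ∈[]? m X = all? λ i → ¬? (i ∈? X) →-dec (lookup m i ℕ.≟ 0)

  ·ₘ-∈[] : ∀ {X} a b → a ∈[ X ] → b ∈[ X ] → (a ·ₘ b) ∈[ X ]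
  ·ₘ-∈[] a b a∈ b∈ i i∉ = trans (lookup-·ₘ a b i) (cong₂ ℕ._+_ (a∈ i i∉) (b∈ i i∉))

  ∣ₘ-∈[] : ∀ {X} a b → a ∣ₘ b → b ∈[ X ] → a ∈[ X ]
  ∣ₘ-∈[] a b a∣b b∈ i i∉ = ℕ.n≤0⇒n≡0 (subst (_ ≤_) (b∈ i i∉) (a∣b i))

  private
    ∉⇒outside : ∀ {X : Subset n} {i} → i ∉ X → lookup X i ≡ outside
    ∉⇒outside {X} {i} i∉ with lookup X i in eq
    ... | inside  = ⊥-elim (i∉ (Vec.lookup⇒[]= i X eq))
    ... | outside = refl

    outside⇒∉ : ∀ {X : Subset n} {i} → lookup X i ≡ outside → i ∉ X
    outside⇒∉ eq i∈ with () ← trans (sym (Vec.[]=⇒lookup i∈)) eq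

    lookup-corestrict : ∀ X (m : Mono n) i → lookup (corestrict X m) i ≡ drop (lookup X i) (lookup m i)
    lookup-corestrict X m i = Vec.lookup-zipWith drop i X m

  ∈[]⇒corestrict≡one : ∀ {X m} → m ∈[ X ] → corestrict X m ≡ one
  ∈[]⇒corestrict≡one {X} {m} m∈ = ≡-pointwise λ i →
    trans (lookup-corestrict X m i) (trans (dropped i (lookup X i) refl) (sym (lookup-one i)))
    where
    dropped : ∀ i s → lookup X i ≡ s → drop s (lookup m i) ≡ 0
    dropped i inside  _  = refl
    dropped i outside eq = m∈ i (outside⇒∉ eq)

  corestrict≡one⇒∈[] : ∀ {X m} → corestrict X m ≡ one → m ∈[ X ]
  corestrict≡one⇒∈[] {X} {m} eq i i∉ = begin
    lookup m i                           ≡⟨ cong (λ s → drop s (lookup m i)) (∉⇒outside i∉) ⟨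
    drop (lookup X i) (lookup m i)       ≡⟨ lookup-corestrict X m i ⟨
    lookup (corestrict X m) i            ≡⟨ cong (λ v → lookup v i) eq ⟩
    lookup one i                         ≡⟨ lookup-one i ⟩
    0                                    ∎
    where open ≡-Reasoning

  ∈[]⇒restrict≡id : ∀ {X m} → m ∈[ X ] → restrict X m ≡ m
  ∈[]⇒restrict≡id {X} {m} m∈ = ≡-pointwise λ i →
    trans (Vec.lookup-zipWith keep i X m) (kept i (lookup X i) refl)
    where
    kept : ∀ i s → lookup X i ≡ s → keep s (lookup m i) ≡ lookup m i
    kept i inside  _  = refl
    kept i outside eq = sym (m∈ i (outside⇒∉ eq))

module EliminationOrder {n : ℕ} (ord : MonomialOrder n) (X : Subset n) where

  open MonomialOrderProperties ord

  ≼X⇒≼ : ∀ {a b} → a ∈[ X ] → b ∈[ X ] → elimRel ord X a b → a ≼ b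
  ≼X⇒≼ a∈ b∈ (inj₁ ≺c) = ⊥-elim (≺-irrefl (subst₂ _≺_
    (∈[]⇒corestrict≡one a∈) (∈[]⇒corestrict≡one b∈) ≺c))
  ≼X⇒≼ a∈ b∈ (inj₂ (_ , ≼r)) = subst₂ _≼_ (∈[]⇒restrict≡id a∈) (∈[]⇒restrict≡id b∈) ≼r

  -- This is what makes ≼_X an elimination ordering.
  ≼X-∈[] : ∀ {a b} → b ∈[ X ] → elimRel ord X a b → a ∈[ X ]
  ≼X-∈[] {a} b∈ (inj₁ ≺c) = ⊥-elim (≺-irrefl
    (≺-≼-trans (subst (corestrict X a ≺_) (∈[]⇒corestrict≡one b∈) ≺c) (oneLeast _)))
  ≼X-∈[] b∈ (inj₂ (≡c , _)) = corestrict≡one⇒∈[] (trans ≡c (∈[]⇒corestrict≡one b∈))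

-- Polynomials

module _ {n : ℕ} where

  coeff-+ₚ : ∀ (p q : Poly n) m → coeff (p +ₚ q) m ≡ coeff p m + coeff q m
  coeff-+ₚ [] q m = sym (ℚ.+-identityˡ _)
  coeff-+ₚ ((c , m′) ∷ p) q m with Vec.≡-dec ℕ._≟_ m′ m
  ... | yes _ = trans (cong (c +_) (coeff-+ₚ p q m)) (sym (ℚ.+-assoc c _ _))
  ... | no  _ = coeff-+ₚ p q m

  coeff-neg : ∀ (p : Poly n) m → coeff (-ₚ p) m ≡ - coeff p m
  coeff-neg [] m = refl
  coeff-neg ((c , m′) ∷ p) m with Vec.≡-dec ℕ._≟_ m′ m
  ... | yes _ = trans (cong (- c +_) (coeff-neg p m)) (sym (ℚ.neg-distrib-+ c _))
  ... | no  _ = coeff-neg p m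

  coeff-·ₚ : ∀ a (p : Poly n) m → coeff (a ·ₚ p) m ≡ a * coeff p m
  coeff-·ₚ a [] m = sym (ℚ.*-zeroʳ a)
  coeff-·ₚ a ((c , m′) ∷ p) m with Vec.≡-dec ℕ._≟_ m′ m
  ... | yes _ = trans (cong (a * c +_) (coeff-·ₚ a p m)) (sym (ℚ.*-distribˡ-+ a c _))
  ... | no  _ = coeff-·ₚ a p m

  coeff-−ₚ : ∀ (p q : Poly n) m → coeff (p -ₚ q) m ≡ coeff p m - coeff q m
  coeff-−ₚ p q m = trans (coeff-+ₚ p (-ₚ q) m) (cong (coeff p m +_) (coeff-neg q m))

  -- A wrapper around _≈_, whose unfolded form ∀ m → coeff p m ≡ coeff q m
  -- would hide p and q from unification.
  infix 4 _≃_
  record _≃_ (p q : Poly n) : Set where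
    constructor coeffwise
    field coeff-≡ : p ≈ q
  open _≃_ public

  ≃-isEquivalence : IsEquivalence _≃_
  ≃-isEquivalence = record
    { refl  = coeffwise λ m → refl
    ; sym   = λ p≃q → coeffwise λ m → sym (coeff-≡ p≃q m)
    ; trans = λ p≃q q≃r → coeffwise λ m → trans (coeff-≡ p≃q m) (coeff-≡ q≃r m)
    }

  ≃-setoid : Setoid 0ℓ 0ℓ
  ≃-setoid = record { isEquivalence = ≃-isEquivalence }

  open IsEquivalence ≃-isEquivalence public
    using () renaming (refl to ≃-refl; sym to ≃-sym; trans to ≃-trans; reflexive to ≡⇒≃)

  +ₚ-cong : {p p′ q q′ : Poly n} → p ≃ p′ → q ≃ q′ → (p +ₚ q) ≃ (p′ +ₚ q′)
  +ₚ-cong {p} {p′} {q} {q′} p≃p′ q≃q′ = coeffwise λ m →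
    trans (coeff-+ₚ p q m) (trans (cong₂ _+_ (coeff-≡ p≃p′ m) (coeff-≡ q≃q′ m)) (sym (coeff-+ₚ p′ q′ m)))

module ≃-Reasoning {n : ℕ} = SetoidReasoning (≃-setoid {n})

module _ {n : ℕ} where

  open ≃-Reasoning

  infixr 25 _⊛_
  infixl 25 _⊛ʳ_

  _⊛_ : ℚ × Mono n → Poly n → Poly n
  s ⊛ q = map (λ t → (proj₁ s * proj₁ t , proj₂ s ·ₘ proj₂ t)) q

  _⊛ʳ_ : Poly n → ℚ × Mono n → Poly n
  q ⊛ʳ s = map (λ t → (proj₁ t * proj₁ s , proj₂ t ·ₘ proj₂ s)) q

  coeff-⊛-·ₘ : ∀ c d (q : Poly n) m → coeff ((c , d) ⊛ q) (d ·ₘ m) ≡ c * coeff q m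
  coeff-⊛-·ₘ c d [] m = sym (ℚ.*-zeroʳ c)
  coeff-⊛-·ₘ c d ((e , m′) ∷ q) m
    with Vec.≡-dec ℕ._≟_ (d ·ₘ m′) (d ·ₘ m) | Vec.≡-dec ℕ._≟_ m′ m
  ... | yes _  | yes _    = trans (cong (c * e +_) (coeff-⊛-·ₘ c d q m)) (sym (ℚ.*-distribˡ-+ c e _))
  ... | yes eq | no m′≢m  = ⊥-elim (m′≢m (·ₘ-cancelˡ d m′ m eq))
  ... | no ne  | yes refl = ⊥-elim (ne refl)
  ... | no _   | no _     = coeff-⊛-·ₘ c d q m

  coeff-⊛-∤ : ∀ c d (q : Poly n) m → ¬ (d ∣ₘ m) → coeff ((c , d) ⊛ q) m ≡ 0ℚ
  coeff-⊛-∤ c d [] m d∤m = refl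
  coeff-⊛-∤ c d ((e , m′) ∷ q) m d∤m with Vec.≡-dec ℕ._≟_ (d ·ₘ m′) m
  ... | yes refl = ⊥-elim (d∤m (∣ₘ-·ₘ d m′))
  ... | no _ = coeff-⊛-∤ c d q m d∤m

  ⊛-cong : ∀ s {q q′ : Poly n} → q ≃ q′ → s ⊛ q ≃ s ⊛ q′
  ⊛-cong (c , d) {q} {q′} q≃q′ = coeffwise λ m → case d ∣ₘ? m of λ where
    (no d∤m) → trans (coeff-⊛-∤ c d q m d∤m) (sym (coeff-⊛-∤ c d q′ m d∤m))
    (yes d∣m) → subst (λ m → coeff ((c , d) ⊛ q) m ≡ coeff ((c , d) ⊛ q′) m) (·ₘ-∸ₘ d∣m)
      (trans (coeff-⊛-·ₘ c d q _) (trans (cong (c *_) (coeff-≡ q≃q′ _)) (sym (coeff-⊛-·ₘ c d q′ _))))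

  *ₚ-congʳ : ∀ (p : Poly n) {q q′} → q ≃ q′ → (p *ₚ q) ≃ (p *ₚ q′)
  *ₚ-congʳ [] q≃q′ = ≃-refl
  *ₚ-congʳ (s ∷ p) q≃q′ = +ₚ-cong (⊛-cong s q≃q′) (*ₚ-congʳ p q≃q′)

  *ₚ-zeroʳ : ∀ (p : Poly n) → p *ₚ 0ₚ ≡ 0ₚ
  *ₚ-zeroʳ [] = refl
  *ₚ-zeroʳ (s ∷ p) = *ₚ-zeroʳ p

  *ₚ-∷ʳ : ∀ (q : Poly n) s p → (q *ₚ (s ∷ p)) ≃ (q ⊛ʳ s +ₚ (q *ₚ p))
  *ₚ-∷ʳ [] s p = ≃-refl
  *ₚ-∷ʳ (t ∷ q) s p = coeffwise λ m → let
      u = (proj₁ t * proj₁ s , proj₂ t ·ₘ proj₂ s)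
      δ = coeff (u ∷ []) m
      A = coeff (t ⊛ p) m
      B = coeff (q ⊛ʳ s) m
      C = coeff (q *ₚ p) m
    in ≡.begin
    coeff ((u ∷ []) +ₚ (t ⊛ p +ₚ (q *ₚ (s ∷ p)))) m
      ≡.≡⟨ coeff-+ₚ (u ∷ []) _ m ⟩
    δ + coeff (t ⊛ p +ₚ (q *ₚ (s ∷ p))) m
      ≡.≡⟨ cong (δ +_) (trans (coeff-+ₚ (t ⊛ p) _ m)
            (cong (A +_) (trans (coeff-≡ (*ₚ-∷ʳ q s p) m) (coeff-+ₚ (q ⊛ʳ s) (q *ₚ p) m)))) ⟩
    δ + (A + (B + C))
      ≡.≡⟨ +-*-Solver.solve 4 (λ δ A B C → δ :+ (A :+ (B :+ C)) := (δ :+ B) :+ (A :+ C)) refl δ A B C ⟩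
    (δ + B) + (A + C)
      ≡.≡⟨ cong₂ _+_ (coeff-+ₚ (u ∷ []) (q ⊛ʳ s) m) (coeff-+ₚ (t ⊛ p) (q *ₚ p) m) ⟨
    coeff (u ∷ q ⊛ʳ s) m + coeff (t ⊛ p +ₚ (q *ₚ p)) m
      ≡.≡⟨ coeff-+ₚ (u ∷ q ⊛ʳ s) _ m ⟨
    coeff ((t ∷ q) ⊛ʳ s +ₚ ((t ∷ q) *ₚ p)) m ≡.∎
    where open +-*-Solver using (_:+_; _:=_)

  ⊛≡⊛ʳ : ∀ s (q : Poly n) → s ⊛ q ≡ q ⊛ʳ s
  ⊛≡⊛ʳ s = List.map-cong λ t → cong₂ _,_ (ℚ.*-comm (proj₁ s) _) (·ₘ-comm (proj₂ s) _)

  *ₚ-comm : ∀ (p q : Poly n) → (p *ₚ q) ≃ (q *ₚ p)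
  *ₚ-comm [] q = ≡⇒≃ (sym (*ₚ-zeroʳ q))
  *ₚ-comm (s ∷ p) q = begin
    s ⊛ q +ₚ (p *ₚ q)    ≈⟨ +ₚ-cong (≡⇒≃ (⊛≡⊛ʳ s q)) (*ₚ-comm p q) ⟩
    q ⊛ʳ s +ₚ (q *ₚ p)   ≈⟨ *ₚ-∷ʳ q s p ⟨
    q *ₚ (s ∷ p)         ∎

  *ₚ-congˡ : ∀ {p p′ : Poly n} q → p ≃ p′ → (p *ₚ q) ≃ (p′ *ₚ q)
  *ₚ-congˡ {p} {p′} q p≃p′ = begin
    p *ₚ q    ≈⟨ *ₚ-comm p q ⟩
    q *ₚ p    ≈⟨ *ₚ-congʳ q p≃p′ ⟩
    q *ₚ p′   ≈⟨ *ₚ-comm q p′ ⟩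
    p′ *ₚ q   ∎

  *ₚ-cong : ∀ {p p′ q q′ : Poly n} → p ≃ p′ → q ≃ q′ → (p *ₚ q) ≃ (p′ *ₚ q′)
  *ₚ-cong {p′ = p′} {q} p≃p′ q≃q′ = ≃-trans (*ₚ-congˡ q p≃p′) (*ₚ-congʳ p′ q≃q′)

  ⊛-⊛ : ∀ s t (r : Poly n) → s ⊛ t ⊛ r ≡ (proj₁ s * proj₁ t , proj₂ s ·ₘ proj₂ t) ⊛ r
  ⊛-⊛ s t r = trans (sym (List.map-∘ r))
    (List.map-cong (λ u → sym (cong₂ _,_ (ℚ.*-assoc (proj₁ s) _ _) (·ₘ-assoc (proj₂ s) _ _))) r)

  ⊛-*ₚ : ∀ s (q r : Poly n) → (s ⊛ q) *ₚ r ≡ s ⊛ (q *ₚ r)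
  ⊛-*ₚ s [] r = refl
  ⊛-*ₚ s (t ∷ q) r = ≡.begin
    (proj₁ s * proj₁ t , proj₂ s ·ₘ proj₂ t) ⊛ r +ₚ ((s ⊛ q) *ₚ r) ≡.≡⟨ cong₂ _+ₚ_ (sym (⊛-⊛ s t r)) (⊛-*ₚ s q r) ⟩
    s ⊛ t ⊛ r +ₚ s ⊛ (q *ₚ r)  ≡.≡⟨ List.map-++ _ (t ⊛ r) (q *ₚ r) ⟨
    s ⊛ (t ⊛ r +ₚ (q *ₚ r))    ≡.∎

  *ₚ-assoc : ∀ (p q r : Poly n) → (p *ₚ q) *ₚ r ≡ p *ₚ (q *ₚ r)
  *ₚ-assoc [] q r = refl
  *ₚ-assoc (s ∷ p) q r = ≡.begin
    (s ⊛ q +ₚ (p *ₚ q)) *ₚ r           ≡.≡⟨ List.concatMap-++ (_⊛ r) (s ⊛ q) (p *ₚ q) ⟩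
    ((s ⊛ q) *ₚ r) +ₚ ((p *ₚ q) *ₚ r)  ≡.≡⟨ cong₂ _+ₚ_ (⊛-*ₚ s q r) (*ₚ-assoc p q r) ⟩
    s ⊛ (q *ₚ r) +ₚ (p *ₚ (q *ₚ r))    ≡.∎

  +ₚ-interchange : ∀ (a b c d : Poly n) → ((a +ₚ b) +ₚ (c +ₚ d)) ≃ ((a +ₚ c) +ₚ (b +ₚ d))
  +ₚ-interchange a b c d = coeffwise λ m → ≡.begin
    coeff ((a +ₚ b) +ₚ (c +ₚ d)) m
      ≡.≡⟨ trans (coeff-+ₚ (a +ₚ b) _ m) (cong₂ _+_ (coeff-+ₚ a b m) (coeff-+ₚ c d m)) ⟩
    (coeff a m + coeff b m) + (coeff c m + coeff d m)
      ≡.≡⟨ +-*-Solver.solve 4 (λ A B C D → (A :+ B) :+ (C :+ D) := (A :+ C) :+ (B :+ D)) refl (coeff a m) (coeff b m) (coeff c m) (coeff d m) ⟩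
    (coeff a m + coeff c m) + (coeff b m + coeff d m)
      ≡.≡⟨ trans (coeff-+ₚ (a +ₚ c) _ m) (cong₂ _+_ (coeff-+ₚ a c m) (coeff-+ₚ b d m)) ⟨
    coeff ((a +ₚ c) +ₚ (b +ₚ d)) m ≡.∎
    where open +-*-Solver using (_:+_; _:=_)

  *ₚ-distribˡ-+ₚ : ∀ (p q r : Poly n) → (p *ₚ (q +ₚ r)) ≃ ((p *ₚ q) +ₚ (p *ₚ r))
  *ₚ-distribˡ-+ₚ [] q r = ≃-refl
  *ₚ-distribˡ-+ₚ (s ∷ p) q r = begin
    s ⊛ (q +ₚ r) +ₚ (p *ₚ (q +ₚ r))
      ≈⟨ +ₚ-cong (≡⇒≃ (List.map-++ _ q r)) (*ₚ-distribˡ-+ₚ p q r) ⟩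
    (s ⊛ q +ₚ s ⊛ r) +ₚ ((p *ₚ q) +ₚ (p *ₚ r))
      ≈⟨ +ₚ-interchange (s ⊛ q) (s ⊛ r) (p *ₚ q) (p *ₚ r) ⟩
    ((s ∷ p) *ₚ q) +ₚ ((s ∷ p) *ₚ r) ∎

  *ₚ-sumₚ : ∀ (p : Poly n) qs → (p *ₚ sumₚ qs) ≃ sumₚ (map (p *ₚ_) qs)
  *ₚ-sumₚ p [] = ≡⇒≃ (*ₚ-zeroʳ p)
  *ₚ-sumₚ p (q ∷ qs) = ≃-trans (*ₚ-distribˡ-+ₚ p q (sumₚ qs)) (+ₚ-cong ≃-refl (*ₚ-sumₚ p qs))

  constant : ℚ → Poly n
  constant c = (c , one) ∷ []

  constant-*ₚ : ∀ c (p : Poly n) → constant c *ₚ p ≡ c ·ₚ p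
  constant-*ₚ c p = trans (List.++-identityʳ _)
    (List.map-cong (λ t → cong (c * proj₁ t ,_) (·ₘ-identityˡ (proj₂ t))) p)

module _ {n : ℕ} where

  InSupp-+ₚ : ∀ (p q : Poly n) {m} → InSupp (p +ₚ q) m → InSupp p m ⊎ InSupp q m
  InSupp-+ₚ p q {m} m∈ with coeff p m ℚ.≟ 0ℚ
  ... | no  m∈p = inj₁ m∈p
  ... | yes p₀ = inj₂ λ q₀ → m∈ (trans (coeff-+ₚ p q m) (cong₂ _+_ p₀ q₀))

  InSupp-·ₚ : ∀ c (p : Poly n) {m} → InSupp (c ·ₚ p) m → InSupp p m
  InSupp-·ₚ c p {m} m∈ p₀ = m∈ (trans (coeff-·ₚ c p m) (trans (cong (c *_) p₀) (ℚ.*-zeroʳ c)))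

  InSupp-neg : ∀ (p : Poly n) {m} → InSupp (-ₚ p) m → InSupp p m
  InSupp-neg p {m} m∈ p₀ = m∈ (trans (coeff-neg p m) (cong -_ p₀))

  InSupp-cong : ∀ {p q : Poly n} {m} → p ≃ q → InSupp p m → InSupp q m
  InSupp-cong p≃q m∈ q₀ = m∈ (trans (coeff-≡ p≃q _) q₀)

  InSupp⇒∈monomials : ∀ (p : Poly n) {m} → InSupp p m → m ∈ map proj₂ p
  InSupp⇒∈monomials [] m∈ = ⊥-elim (m∈ refl)
  InSupp⇒∈monomials ((c , m′) ∷ p) {m} m∈ with Vec.≡-dec ℕ._≟_ m′ m
  ... | yes m′≡m = here (sym m′≡m)
  ... | no  _    = there (InSupp⇒∈monomials p m∈)

  InSupp-+ₚ-≡0 : ∀ (p q : Poly n) {m} → coeff q m ≡ 0ℚ → InSupp p m → InSupp (p +ₚ q) m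
  InSupp-+ₚ-≡0 p q {m} q₀ m∈p p+q₀ =
    m∈p (trans (sym (ℚ.+-identityʳ _)) (trans (cong (coeff p m +_) (sym q₀)) (trans (sym (coeff-+ₚ p q m)) p+q₀)))

  InSupp-⊛ : ∀ c d (q : Poly n) {m} → InSupp ((c , d) ⊛ q) m →
             Σ (Mono n) λ m′ → m ≡ d ·ₘ m′ × InSupp q m′
  InSupp-⊛ c d q {m} m∈ with d ∣ₘ? m
  ... | no  d∤m = ⊥-elim (m∈ (coeff-⊛-∤ c d q m d∤m))
  ... | yes d∣m = m ∸ₘ d , sym (·ₘ-∸ₘ d∣m) , λ q₀ → m∈ (subst (λ m → coeff ((c , d) ⊛ q) m ≡ 0ℚ) (·ₘ-∸ₘ d∣m)
                    (trans (coeff-⊛-·ₘ c d q (m ∸ₘ d)) (trans (cong (c *_) q₀) (ℚ.*-zeroʳ c))))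

  InQ-⊤ : ∀ (p : Poly n) → InQ ⊤ p
  InQ-⊤ p m _ i i∉⊤ = ⊥-elim (i∉⊤ ∈⊤)

  module _ {X : Subset n} where

    InQ-cong : ∀ {p q} → p ≃ q → InQ X p → InQ X q
    InQ-cong p≃q p∈ m m∈ = p∈ m (InSupp-cong (≃-sym p≃q) m∈)

    InQ-+ₚ : ∀ p q → InQ X p → InQ X q → InQ X (p +ₚ q)
    InQ-+ₚ p q p∈ q∈ m m∈ with InSupp-+ₚ p q m∈
    ... | inj₁ m∈p = p∈ m m∈p
    ... | inj₂ m∈q = q∈ m m∈q

    InQ-+ₚ⁻ʳ : ∀ p {q} → InQ X (p +ₚ q) → InQ X p → InQ X q
    InQ-+ₚ⁻ʳ p {q} p+q∈ p∈ m m∈q with coeff p m ℚ.≟ 0ℚ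
    ... | no  m∈p = p∈ m m∈p
    ... | yes p₀  = p+q∈ m λ p+q₀ → m∈q (begin
      coeff q m                 ≡⟨ ℚ.+-identityˡ _ ⟨
      0ℚ + coeff q m            ≡⟨ cong (_+ coeff q m) p₀ ⟨
      coeff p m + coeff q m     ≡⟨ coeff-+ₚ p q m ⟨
      coeff (p +ₚ q) m          ≡⟨ p+q₀ ⟩
      0ℚ                        ∎)
      where open ≡-Reasoning

    InQ-neg : ∀ p → InQ X p → InQ X (-ₚ p)
    InQ-neg p p∈ m m∈ = p∈ m (InSupp-neg p m∈)

    InQ-sumₚ : ∀ ps → All (InQ X) ps → InQ X (sumₚ ps)
    InQ-sumₚ [] [] m m∈ = ⊥-elim (m∈ refl)
    InQ-sumₚ (p ∷ ps) (p∈ ∷ ps∈) = InQ-+ₚ p (sumₚ ps) p∈ (InQ-sumₚ ps ps∈)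

    TermsOver : Poly n → Set
    TermsOver p = All (λ t → proj₂ t ∈[ X ]) p

    TermsOver⇒InQ : ∀ {p} → TermsOver p → InQ X p
    TermsOver⇒InQ {p} ts m m∈ = All.lookup (All.map⁺ ts) (InSupp⇒∈monomials p m∈)

    TermsOver-*ₚ : ∀ {p q} → TermsOver p → TermsOver q → TermsOver (p *ₚ q)
    TermsOver-*ₚ [] tq = []
    TermsOver-*ₚ {s ∷ _} (s∈ ∷ tp) tq =
      All.++⁺ (All.map⁺ (All.map (λ {t} → ·ₘ-∈[] (proj₂ s) (proj₂ t) s∈) tq)) (TermsOver-*ₚ tp tq)

    termsOver : Poly n → Poly n
    termsOver = filter (λ t → ∈[]? (proj₂ t) X)

    coeff-termsOver-∈ : ∀ p {m} → m ∈[ X ] → coeff (termsOver p) m ≡ coeff p m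
    coeff-termsOver-∈ [] m∈ = refl
    coeff-termsOver-∈ ((c , m′) ∷ p) {m} m∈ with ∈[]? m′ X
    ... | yes _ with Vec.≡-dec ℕ._≟_ m′ m
    ...   | yes _ = cong (c +_) (coeff-termsOver-∈ p m∈)
    ...   | no  _ = coeff-termsOver-∈ p m∈
    coeff-termsOver-∈ ((c , m′) ∷ p) {m} m∈ | no m′∉ with Vec.≡-dec ℕ._≟_ m′ m
    ...   | yes refl = ⊥-elim (m′∉ m∈)
    ...   | no  _    = coeff-termsOver-∈ p m∈

    coeff-termsOver-∉ : ∀ p {m} → ¬ m ∈[ X ] → coeff (termsOver p) m ≡ 0ℚ
    coeff-termsOver-∉ [] m∉ = refl
    coeff-termsOver-∉ ((c , m′) ∷ p) {m} m∉ with ∈[]? m′ X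
    ... | no _ = coeff-termsOver-∉ p m∉
    ... | yes m′∈ with Vec.≡-dec ℕ._≟_ m′ m
    ...   | yes refl = ⊥-elim (m∉ m′∈)
    ...   | no  _    = coeff-termsOver-∉ p m∉

    termsOver-≃ : ∀ p → InQ X p → termsOver p ≃ p
    termsOver-≃ p p∈ = coeffwise λ m → case ∈[]? m X of λ where
      (yes m∈) → coeff-termsOver-∈ p m∈
      (no  m∉) → trans (coeff-termsOver-∉ p m∉) (case coeff p m ℚ.≟ 0ℚ of λ where
        (yes p₀)  → sym p₀
        (no  m∈p) → ⊥-elim (m∉ (p∈ m m∈p)))

    TermsOver-termsOver : ∀ p → TermsOver (termsOver p)
    TermsOver-termsOver = All.all-filter (λ t → ∈[]? (proj₂ t) X)

    -- A polynomial over X may still list cancelling terms outside X, so both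
    -- factors are first filtered to their terms over X.
    InQ-*ₚ : ∀ p q → InQ X p → InQ X q → InQ X (p *ₚ q)
    InQ-*ₚ p q p∈ q∈ = InQ-cong (*ₚ-cong (termsOver-≃ p p∈) (termsOver-≃ q q∈))
      (TermsOver⇒InQ (TermsOver-*ₚ (TermsOver-termsOver p) (TermsOver-termsOver q)))

-- Ideals and cones

module _ {n : ℕ} where

  open ≃-Reasoning

  combination : List (Poly n × Poly n) → Poly n
  combination cs = sumₚ (map (λ c → proj₁ c *ₚ proj₂ c) cs)

  sumₚ-++ : ∀ (ps qs : List (Poly n)) → sumₚ (ps ++ qs) ≡ sumₚ ps +ₚ sumₚ qs
  sumₚ-++ ps qs = sym (List.concat-++ ps qs)

  module _ {V : Subset n} {Z : List (Poly n)} where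

    InIdeal-cong : ∀ {f g} → f ≃ g → InIdeal V Z f → InIdeal V Z g
    InIdeal-cong f≃g (cs , cs∈ , gs∈ , f≈) = cs , cs∈ , gs∈ , λ m → trans (sym (coeff-≡ f≃g m)) (f≈ m)

    InIdeal-0ₚ : InIdeal V Z 0ₚ
    InIdeal-0ₚ = [] , [] , [] , λ m → refl

    InIdeal-generator : ∀ a {z} → InQ V a → z ∈ Z → InIdeal V Z (a *ₚ z)
    InIdeal-generator a {z} a∈ z∈ =
      (a , z) ∷ [] , a∈ ∷ [] , z∈ ∷ [] , coeff-≡ (≡⇒≃ (sym (List.++-identityʳ (a *ₚ z))))

    InIdeal-+ₚ : ∀ f g → InIdeal V Z f → InIdeal V Z g → InIdeal V Z (f +ₚ g)
    InIdeal-+ₚ f g (cs , cs∈ , gs∈ , f≈) (ds , ds∈ , hs∈ , g≈) =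
      cs ++ ds , All.++⁺ cs∈ ds∈ , All.++⁺ gs∈ hs∈ , coeff-≡ (begin
        f +ₚ g                                ≈⟨ +ₚ-cong f≃ g≃ ⟩
        combination cs +ₚ combination ds      ≡⟨ sumₚ-++ (map _ cs) (map _ ds) ⟨
        sumₚ (map _ cs ++ map _ ds)           ≡⟨ cong sumₚ (List.map-++ _ cs ds) ⟨
        combination (cs ++ ds)                ∎)
      where
      f≃ : f ≃ combination cs
      f≃ = coeffwise f≈
      g≃ : g ≃ combination ds
      g≃ = coeffwise g≈

  InIdeal-*ₚ : ∀ {Z} h (f : Poly n) → InIdeal ⊤ Z f → InIdeal ⊤ Z (h *ₚ f)
  InIdeal-*ₚ h f (cs , _ , gs∈ , f≈) =
    map multiply cs , All.map⁺ (All.universal (λ c → InQ-⊤ (h *ₚ proj₁ c)) cs) , All.map⁺ gs∈ ,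
    coeff-≡ (begin
      h *ₚ f                                    ≈⟨ *ₚ-congʳ h f≃ ⟩
      h *ₚ combination cs                       ≈⟨ *ₚ-sumₚ h (map _ cs) ⟩
      sumₚ (map (h *ₚ_) (map _ cs))             ≡⟨ cong sumₚ (List.map-∘ cs) ⟨
      sumₚ (map (λ c → h *ₚ (proj₁ c *ₚ proj₂ c)) cs)
        ≡⟨ cong sumₚ (List.map-cong (λ c → sym (*ₚ-assoc h (proj₁ c) (proj₂ c))) cs) ⟩
      sumₚ (map (λ c → (h *ₚ proj₁ c) *ₚ proj₂ c) cs) ≡⟨ cong sumₚ (List.map-∘ cs) ⟩
      combination (map multiply cs)             ∎)
    where
    multiply : Poly n × Poly n → Poly n × Poly n
    multiply c = h *ₚ proj₁ c , proj₂ c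
    f≃ : f ≃ combination cs
    f≃ = coeffwise f≈

  InIdeal-·ₚ : ∀ {Z} c (f : Poly n) → InIdeal ⊤ Z f → InIdeal ⊤ Z (c ·ₚ f)
  InIdeal-·ₚ c f f∈ = InIdeal-cong (≡⇒≃ (constant-*ₚ c f)) (InIdeal-*ₚ (constant c) f f∈)

  InIdeal-neg : ∀ {Z} (f : Poly n) → InIdeal ⊤ Z f → InIdeal ⊤ Z (-ₚ f)
  InIdeal-neg f f∈ = InIdeal-cong -1·f≃-f (InIdeal-·ₚ (- 1ℚ) f f∈)
    where
    -1·f≃-f : ((- 1ℚ) ·ₚ f) ≃ (-ₚ f)
    -1·f≃-f = coeffwise λ m → trans (coeff-·ₚ (- 1ℚ) f m)
      (trans (sym (ℚ.neg-distribˡ-* 1ℚ (coeff f m))) (trans (cong -_ (ℚ.*-identityˡ (coeff f m))) (sym (coeff-neg f m))))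

  InIdeal-⊆ : ∀ {V Z G} → (∀ {g} → g ∈ G → InIdeal ⊤ Z g) → ∀ f → InIdeal V G f → InIdeal ⊤ Z f
  InIdeal-⊆ {Z = Z} G⊆Z f (cs , _ , gs∈ , f≈) = InIdeal-cong (≃-sym f≃) (go cs gs∈)
    where
    f≃ : f ≃ combination cs
    f≃ = coeffwise f≈

    go : ∀ cs → All (λ c → proj₂ c ∈ _) cs → InIdeal ⊤ Z (combination cs)
    go [] [] = InIdeal-0ₚ
    go ((a , g) ∷ cs) (g∈ ∷ gs∈) = InIdeal-+ₚ (a *ₚ g) (combination cs) (InIdeal-*ₚ a g (G⊆Z g∈)) (go cs gs∈)

  InIdeal⇒InQ : ∀ {V Z} → (∀ {z} → z ∈ Z → InQ V z) → ∀ f → InIdeal V Z f → InQ V f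
  InIdeal⇒InQ {V} Z⊆ f (cs , as∈ , zs∈ , f≈) =
    InQ-cong (≃-sym f≃) (InQ-sumₚ _ (All.map⁺ (products cs as∈ zs∈)))
    where
    f≃ : f ≃ combination cs
    f≃ = coeffwise f≈

    products : ∀ cs → All (λ c → InQ V (proj₁ c)) cs → All (λ c → proj₂ c ∈ _) cs →
               All (λ c → InQ V (proj₁ c *ₚ proj₂ c)) cs
    products [] [] [] = []
    products ((a , z) ∷ cs) (a∈ ∷ as∈) (z∈ ∷ zs∈) = InQ-*ₚ a z a∈ (Z⊆ z∈) ∷ products cs as∈ zs∈

module _ {n : ℕ} where

  open ≃-Reasoning

  scaledSum : List (ℚ × Poly n) → Poly n
  scaledSum cs = sumₚ (map (λ c → proj₁ c ·ₚ proj₂ c) cs)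

  InSupp-scaledSum : ∀ {P : List (Poly n)} cs {m} → All (λ c → proj₂ c ∈ P) cs →
                     InSupp (scaledSum cs) m → Σ (Poly n) λ p → p ∈ P × InSupp p m
  InSupp-scaledSum [] [] m∈ = ⊥-elim (m∈ refl)
  InSupp-scaledSum ((l , p) ∷ cs) (p∈ ∷ ps∈) m∈ with InSupp-+ₚ (l ·ₚ p) (scaledSum cs) m∈
  ... | inj₁ m∈lp = p , p∈ , InSupp-·ₚ l p m∈lp
  ... | inj₂ m∈cs = InSupp-scaledSum cs ps∈ m∈cs

  InCone⇒InSupp : ∀ {P : List (Poly n)} s {m} → InCone P s → InSupp s m →
                  Σ (Poly n) λ p → p ∈ P × InSupp p m
  InCone⇒InSupp s (cs , _ , ps∈ , s≈) m∈ = InSupp-scaledSum cs ps∈ (InSupp-cong s≃ m∈)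
    where
    s≃ : s ≃ scaledSum cs
    s≃ = coeffwise s≈

  module _ {V : Subset n} {Z P : List (Poly n)} where

    InAlgCone-cong : ∀ {f g} → f ≃ g → InAlgCone V Z P f → InAlgCone V Z P g
    InAlgCone-cong f≃g (a , b , a∈ , b∈ , f≈) = a , b , a∈ , b∈ , λ m → trans (sym (coeff-≡ f≃g m)) (f≈ m)

    InAlgCone-+ₚ-ideal : ∀ e f → InIdeal V Z e → InAlgCone V Z P f → InAlgCone V Z P (e +ₚ f)
    InAlgCone-+ₚ-ideal e f e∈ (a , b , a∈ , b∈ , f≈) =
      e +ₚ a , b , InIdeal-+ₚ e a e∈ a∈ , b∈ , coeff-≡ (begin
        e +ₚ f          ≈⟨ +ₚ-cong ≃-refl f≃ ⟩
        e +ₚ (a +ₚ b)   ≡⟨ List.++-assoc e a b ⟨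
        (e +ₚ a) +ₚ b   ∎)
      where
      f≃ : f ≃ (a +ₚ b)
      f≃ = coeffwise f≈

  ·ₚ-split : ∀ l (a b : Poly n) → (l ·ₚ a) ≃ ((l ·ₚ (a -ₚ b)) +ₚ (l ·ₚ b))
  ·ₚ-split l a b = coeffwise λ m → ≡.begin
    coeff (l ·ₚ a) m                           ≡.≡⟨ coeff-·ₚ l a m ⟩
    l * coeff a m
      ≡.≡⟨ +-*-Solver.solve 3 (λ l a b → l :* a := l :* (a :- b) :+ l :* b) refl l (coeff a m) (coeff b m) ⟩
    l * (coeff a m - coeff b m) + l * coeff b m
      ≡.≡⟨ cong₂ _+_ (trans (coeff-·ₚ l (a -ₚ b) m) (cong (l *_) (coeff-−ₚ a b m))) (coeff-·ₚ l b m) ⟨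
    coeff (l ·ₚ (a -ₚ b)) m + coeff (l ·ₚ b) m ≡.≡⟨ coeff-+ₚ (l ·ₚ (a -ₚ b)) (l ·ₚ b) m ⟨
    coeff ((l ·ₚ (a -ₚ b)) +ₚ (l ·ₚ b)) m      ≡.∎
    where open +-*-Solver using (_:+_; _:*_; _:-_; _:=_)

  InCone⇒InAlgCone : ∀ {Z A B : List (Poly n)} →
    (∀ {a} → a ∈ A → Σ (Poly n) λ b → b ∈ B × InIdeal ⊤ Z (a -ₚ b)) →
    ∀ f → InCone A f → InAlgCone ⊤ Z B f
  InCone⇒InAlgCone {Z} {A} {B} A⇝B f (cs , cs≥0 , as∈ , f≈) =
    InAlgCone-cong (≃-sym f≃) (scaledSum-∈ cs cs≥0 as∈)
    where
    f≃ : f ≃ scaledSum cs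
    f≃ = coeffwise f≈

    scaledSum-∈ : ∀ cs → All (λ c → 0ℚ ℚ.≤ proj₁ c) cs → All (λ c → proj₂ c ∈ A) cs →
                  InAlgCone ⊤ Z B (scaledSum cs)
    scaledSum-∈ [] [] [] = 0ₚ , 0ₚ , InIdeal-0ₚ , ([] , [] , [] , λ m → refl) , λ m → refl
    scaledSum-∈ ((l , a) ∷ cs) (l≥0 ∷ cs≥0) (a∈ ∷ as∈)
      with A⇝B a∈ | scaledSum-∈ cs cs≥0 as∈
    ... | b , b∈ , a-b∈ | e , c , e∈ , (ds , ds≥0 , bs∈ , c≈) , cs≈ =
      (l ·ₚ (a -ₚ b)) +ₚ e , (l ·ₚ b) +ₚ c ,
      InIdeal-+ₚ (l ·ₚ (a -ₚ b)) e (InIdeal-·ₚ l (a -ₚ b) a-b∈) e∈ ,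
      ((l , b) ∷ ds , l≥0 ∷ ds≥0 , b∈ ∷ bs∈ , coeff-≡ (+ₚ-cong (≃-refl {x = l ·ₚ b}) c≃)) ,
      coeff-≡ (begin
        (l ·ₚ a) +ₚ scaledSum cs                         ≈⟨ +ₚ-cong (·ₚ-split l a b) cs≃ ⟩
        ((l ·ₚ (a -ₚ b)) +ₚ (l ·ₚ b)) +ₚ (e +ₚ c)        ≈⟨ +ₚ-interchange (l ·ₚ (a -ₚ b)) (l ·ₚ b) e c ⟩
        ((l ·ₚ (a -ₚ b)) +ₚ e) +ₚ ((l ·ₚ b) +ₚ c)        ∎)
      where
      c≃ : c ≃ scaledSum ds
      c≃ = coeffwise c≈
      cs≃ : scaledSum cs ≃ (e +ₚ c)
      cs≃ = coeffwise cs≈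

module LeadingMonomial {n : ℕ} {_≤_ : Rel≼ n} (isTotalOrder : IsTotalOrder _≡_ _≤_) where

  private
    totalOrder : TotalOrder 0ℓ 0ℓ 0ℓ
    totalOrder = record { isTotalOrder = isTotalOrder }
    open Extrema totalOrder using (max; xs≤max; argmax-all)

  InSupp? : ∀ (h : Poly n) m → Dec (InSupp h m)
  InSupp? h m = ¬? (coeff h m ℚ.≟ 0ℚ)

  leadingMonomial : ∀ (h : Poly n) → (Σ (Mono n) λ M → IsLM _≤_ h M) ⊎ h ≃ 0ₚ
  leadingMonomial h with Any.any? (InSupp? h) (map proj₂ h)
  ... | no  none = inj₂ (coeffwise λ m → case coeff h m ℚ.≟ 0ℚ of λ where
          (yes h₀) → h₀
          (no  m∈) → ⊥-elim (none (Any.map (λ { refl → m∈ }) (InSupp⇒∈monomials h m∈))))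
  ... | yes some = inj₁ (M , argmax-all (λ m → m) (proj₂ (Any.satisfied some)) (All.all-filter (InSupp? h) (map proj₂ h)) ,
                         λ m m∈ → All.lookup (xs≤max _ support) (∈-filter⁺ (InSupp? h) (InSupp⇒∈monomials h m∈) m∈))
    where
    support = filter (InSupp? h) (map proj₂ h)
    M = max (proj₁ (Any.satisfied some)) support

-- Elimination

module Elimination {n : ℕ} (ord : MonomialOrder n) (X : Subset n) where

  open MonomialOrderProperties ord
  open EliminationOrder ord X
  open LeadingMonomial isTotal

  Irreducible : List (Poly n) → Mono n → Set
  Irreducible G m = ∀ g → g ∈ G → ∀ lg → IsLM (elimRel ord X) g lg → lg ∣ₘ m → ⊥

  InQ-idealPart : ∀ {Z G} → IsGroebner (elimRel ord X) Z G → ∀ h s → InIdeal ⊤ Z h →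
                  (∀ m → InSupp s m → Irreducible G m) → InQ X (h +ₚ s) → InQ X h
  InQ-idealPart (_ , groebner) h s h∈Z s-irreducible h+s∈X m m∈h
    with groebner h h∈Z (m , m∈h)
  ... | g , g∈G , lg , lh , lm-g , (lh∈h , ≼lh) , lg∣lh with ∈[]? lh X
  ...   | yes lh∈X = ≼X-∈[] lh∈X (≼lh m m∈h)
  ...   | no  lh∉X = ⊥-elim (s-irreducible lh lh∈s g g∈G lg lm-g lg∣lh)
    where
    lh∈s : InSupp s lh
    lh∈s s₀ = lh∉X (h+s∈X lh (InSupp-+ₚ-≡0 h s s₀ lh∈h))

  module _ {Z G GX : List (Poly n)} (groebner : IsGroebner (elimRel ord X) Z G)
           (GX-spec : ∀ g → (g ∈ GX) ⇔ (g ∈ G × InQ X g)) where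

    G⊆⟨Z⟩ : ∀ {g} → g ∈ G → InIdeal ⊤ Z g
    G⊆⟨Z⟩ g∈ = All.lookup (proj₁ groebner) g∈

    module DivisionStep {h M} (h∈X : InQ X h) (lm-h : IsLM _≼_ h M) {g lg} (g∈G : g ∈ G)
                        (lm-g : IsLM (elimRel ord X) g lg) (lg∣M : lg ∣ₘ M) where

      M∈X : M ∈[ X ]
      M∈X = h∈X M (proj₁ lm-h)

      g∈X : InQ X g
      g∈X m m∈ = ≼X-∈[] (∣ₘ-∈[] lg M lg∣M M∈X) (proj₂ lm-g m m∈)

      g∈GX : g ∈ GX
      g∈GX = Equivalence.from (GX-spec g) (g∈G , g∈X)

      c : ℚ
      c = coeff h M * ℚ.1/_ (coeff g lg) {{ℚ.≢-nonZero (proj₁ lm-g)}}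

      d : Mono n
      d = M ∸ₘ lg

      quotient : Poly n
      quotient = (c , d) ∷ []

      quotient∈X : InQ X quotient
      quotient∈X = TermsOver⇒InQ {p = quotient} (∣ₘ-∈[] d M (∸ₘ-∣ₘ lg M) M∈X ∷ [])

      remainder : Poly n
      remainder = h -ₚ (quotient *ₚ g)

      coeff-quotient*g : ∀ m → coeff (quotient *ₚ g) m ≡ coeff ((c , d) ⊛ g) m
      coeff-quotient*g m = cong (λ p → coeff p m) (List.++-identityʳ ((c , d) ⊛ g))

      d·lg≡M : d ·ₘ lg ≡ M
      d·lg≡M = trans (·ₘ-comm d lg) (·ₘ-∸ₘ lg∣M)

      h≃ : h ≃ ((quotient *ₚ g) +ₚ remainder)
      h≃ = coeffwise λ m → sym (trans (coeff-+ₚ (quotient *ₚ g) remainder m)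
        (trans (cong (coeff (quotient *ₚ g) m +_) (coeff-−ₚ h (quotient *ₚ g) m)) (a+[b-a]≡b (coeff (quotient *ₚ g) m) (coeff h m))))
        where
        open +-*-Solver using (_:+_; _:-_; _:=_)
        a+[b-a]≡b : ∀ a b → a + (b - a) ≡ b
        a+[b-a]≡b = +-*-Solver.solve 2 (λ a b → a :+ (b :- a) := b) refl

      remainder∈X : InQ X remainder
      remainder∈X = InQ-+ₚ h _ h∈X (InQ-neg (quotient *ₚ g) (InQ-*ₚ quotient g quotient∈X g∈X))

      remainder∈⟨Z⟩ : InIdeal ⊤ Z h → InIdeal ⊤ Z remainder
      remainder∈⟨Z⟩ h∈Z = InIdeal-+ₚ h _ h∈Z (InIdeal-neg (quotient *ₚ g) (InIdeal-*ₚ quotient g (G⊆⟨Z⟩ g∈G)))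

      coeff-remainder-M : coeff remainder M ≡ 0ℚ
      coeff-remainder-M = begin
        coeff remainder M                            ≡⟨ coeff-−ₚ h (quotient *ₚ g) M ⟩
        coeff h M - coeff (quotient *ₚ g) M          ≡⟨ cong (_-_ (coeff h M)) (trans (coeff-quotient*g M)
                                                           (subst (λ M′ → coeff ((c , d) ⊛ g) M′ ≡ c * coeff g lg) d·lg≡M
                                                             (coeff-⊛-·ₘ c d g lg))) ⟩
        coeff h M - c * coeff g lg                   ≡⟨ cong (_-_ (coeff h M)) c·lc≡lc ⟩
        coeff h M - coeff h M                        ≡⟨ ℚ.+-inverseʳ (coeff h M) ⟩
        0ℚ                                           ∎
        where
        open ≡-Reasoning
        c·lc≡lc : c * coeff g lg ≡ coeff h M
        c·lc≡lc = trans (ℚ.*-assoc (coeff h M) _ _)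
          (trans (cong (coeff h M *_) (ℚ.*-inverseˡ (coeff g lg) {{ℚ.≢-nonZero (proj₁ lm-g)}}))
                 (ℚ.*-identityʳ (coeff h M)))

      remainder≼M : ∀ m → InSupp remainder m → m ≼ M
      remainder≼M m m∈ with InSupp-+ₚ h (-ₚ (quotient *ₚ g)) m∈
      ... | inj₁ m∈h = proj₂ lm-h m m∈h
      ... | inj₂ m∈qg with InSupp-⊛ c d g (λ qg₀ → InSupp-neg (quotient *ₚ g) m∈qg (trans (coeff-quotient*g m) qg₀))
      ...   | m′ , refl , m′∈g = subst ((d ·ₘ m′) ≼_) d·lg≡M
                (·ₘ-monoʳ-≼ d (≼X⇒≼ (g∈X m′ m′∈g) (∣ₘ-∈[] lg M lg∣M M∈X) (proj₂ lm-g m′ m′∈g)))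

    divide : ∀ {M} → Acc _≺_ M → ∀ h → InIdeal ⊤ Z h → InQ X h → IsLM _≼_ h M → InIdeal X GX h
    divide {M} (acc rs) h h∈Z h∈X lm-h with proj₂ groebner h h∈Z (M , proj₁ lm-h)
    ... | g , g∈G , lg , lh , lm-g , (lh∈h , ≼lh) , lg∣lh =
      InIdeal-cong (≃-sym h≃)
        (InIdeal-+ₚ (quotient *ₚ g) remainder (InIdeal-generator quotient quotient∈X g∈GX) remainder∈⟨GX⟩)
      where
      lh≡M : lh ≡ M
      lh≡M = ≼-antisym (proj₂ lm-h lh lh∈h)
        (≼X⇒≼ (h∈X M (proj₁ lm-h)) (h∈X lh lh∈h) (≼lh M (proj₁ lm-h)))

      open DivisionStep {h} h∈X lm-h g∈G lm-g (subst (lg ∣ₘ_) lh≡M lg∣lh)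

      remainder∈⟨GX⟩ : InIdeal X GX remainder
      remainder∈⟨GX⟩ with leadingMonomial remainder
      ... | inj₂ r≃0 = InIdeal-cong (≃-sym r≃0) InIdeal-0ₚ
      ... | inj₁ (M′ , lm-r) = divide (rs (remainder≼M M′ (proj₁ lm-r) , λ { refl → proj₁ lm-r coeff-remainder-M }))
                                 remainder (remainder∈⟨Z⟩ h∈Z) remainder∈X lm-r

    ⟨Z⟩∩ℚ[X]⊆⟨GX⟩ : ∀ h → InIdeal ⊤ Z h → InQ X h → InIdeal X GX h
    ⟨Z⟩∩ℚ[X]⊆⟨GX⟩ h h∈Z h∈X with leadingMonomial h
    ... | inj₂ h≃0 = InIdeal-cong (≃-sym h≃0) InIdeal-0ₚ
    ... | inj₁ (M , lm-h) = divide (≺-wellFounded M) h h∈Z h∈X lm-h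

module _ {A B : Set} {_∼_ : A → B → Set} where

  Pointwise-∈ˡ : ∀ {xs ys} → Pointwise _∼_ xs ys → ∀ {x} → x ∈ xs → Σ B λ y → y ∈ ys × x ∼ y
  Pointwise-∈ˡ (x∼y ∷ _) (here refl) = _ , here refl , x∼y
  Pointwise-∈ˡ (_ ∷ xs∼ys) (there x∈) with Pointwise-∈ˡ xs∼ys x∈
  ... | y , y∈ , x∼y = y , there y∈ , x∼y

  Pointwise-∈ʳ : ∀ {xs ys} → Pointwise _∼_ xs ys → ∀ {y} → y ∈ ys → Σ A λ x → x ∈ xs × x ∼ y
  Pointwise-∈ʳ (x∼y ∷ _) (here refl) = _ , here refl , x∼y
  Pointwise-∈ʳ (_ ∷ xs∼ys) (there y∈) with Pointwise-∈ʳ xs∼ys y∈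
  ... | x , x∈ , x∼y = x , there x∈ , x∼y

module Projection {n : ℕ} (ord : MonomialOrder n) (X : Subset n) {Z P G GX R Q : List (Poly n)}
  (groebner : IsGroebner (elimRel ord X) Z G) (GX-spec : ∀ g → (g ∈ GX) ⇔ (g ∈ G × InQ X g))
  (normalForms : Pointwise (IsNormalForm (elimRel ord X) G) P R)
  (Q-spec : ∀ f → InCone Q f ⇔ (InCone R f × InQ X f)) where

  open Elimination ord X
  open ≃-Reasoning

  GX⊆⟨Z⟩ : ∀ {g} → g ∈ GX → InIdeal ⊤ Z g
  GX⊆⟨Z⟩ g∈ = G⊆⟨Z⟩ groebner GX-spec (proj₁ (Equivalence.to (GX-spec _) g∈))

  GX⊆ℚ[X] : ∀ {g} → g ∈ GX → InQ X g
  GX⊆ℚ[X] g∈ = proj₂ (Equivalence.to (GX-spec _) g∈)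

  P⇝R : ∀ {p} → p ∈ P → Σ (Poly n) λ r → r ∈ R × InIdeal ⊤ Z (p -ₚ r)
  P⇝R {p} p∈ with Pointwise-∈ˡ normalForms p∈
  ... | r , r∈ , (p-r∈⟨G⟩ , _) = r , r∈ , InIdeal-⊆ (G⊆⟨Z⟩ groebner GX-spec) (p -ₚ r) p-r∈⟨G⟩

  R⇝P : ∀ {r} → r ∈ R → Σ (Poly n) λ p → p ∈ P × InIdeal ⊤ Z (r -ₚ p)
  R⇝P {r} r∈ with Pointwise-∈ʳ normalForms r∈
  ... | p , p∈ , (p-r∈⟨G⟩ , _) =
    p , p∈ , InIdeal-cong -[p-r]≃r-p (InIdeal-neg (p -ₚ r) (InIdeal-⊆ (G⊆⟨Z⟩ groebner GX-spec) (p -ₚ r) p-r∈⟨G⟩))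
    where
    open +-*-Solver using (_:-_; :-_; _:=_)
    -[p-r]≃r-p : (-ₚ (p -ₚ r)) ≃ (r -ₚ p)
    -[p-r]≃r-p = coeffwise λ m → ≡.begin
      coeff (-ₚ (p -ₚ r)) m        ≡.≡⟨ trans (coeff-neg (p -ₚ r) m) (cong -_ (coeff-−ₚ p r m)) ⟩
      - (coeff p m - coeff r m)    ≡.≡⟨ +-*-Solver.solve 2 (λ a b → :- (a :- b) := b :- a) refl (coeff p m) (coeff r m) ⟩
      coeff r m - coeff p m        ≡.≡⟨ coeff-−ₚ r p m ⟨
      coeff (r -ₚ p) m             ≡.∎

  InCone-R-irreducible : ∀ s → InCone R s → ∀ m → InSupp s m → Irreducible G m
  InCone-R-irreducible s s∈ m m∈ with InCone⇒InSupp s s∈ m∈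
  ... | r , r∈ , m∈r with Pointwise-∈ʳ normalForms r∈
  ...   | _ , _ , (_ , r-irreducible) = r-irreducible m m∈r

  projection-sound : ∀ f → InAlgCone X GX Q f → InAlgCone ⊤ Z P f × InQ X f
  projection-sound f (a , b , a∈ , b∈Q , f≈) with Equivalence.to (Q-spec b) b∈Q
  ... | b∈R , b∈X =
    InAlgCone-cong (≃-sym f≃) (InAlgCone-+ₚ-ideal a b (InIdeal-⊆ GX⊆⟨Z⟩ a a∈) (InCone⇒InAlgCone R⇝P b b∈R)) ,
    InQ-cong (≃-sym f≃) (InQ-+ₚ a b (InIdeal⇒InQ GX⊆ℚ[X] a a∈) b∈X)
    where
    f≃ : f ≃ (a +ₚ b)
    f≃ = coeffwise f≈

  projection-complete : ∀ f → InAlgCone ⊤ Z P f × InQ X f → InAlgCone X GX Q f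
  projection-complete f ((a , b , a∈ , b∈P , f≈) , f∈X) with InCone⇒InAlgCone P⇝R b b∈P
  ... | e , s , e∈ , s∈R , b≈ =
    h , s , ⟨Z⟩∩ℚ[X]⊆⟨GX⟩ groebner GX-spec h h∈⟨Z⟩ h∈X , Equivalence.from (Q-spec s) (s∈R , s∈X) , coeff-≡ f≃
    where
    h = a +ₚ e
    h∈⟨Z⟩ = InIdeal-+ₚ a e a∈ e∈

    f≃ : f ≃ (h +ₚ s)
    f≃ = begin
      f                 ≈⟨ coeffwise f≈ ⟩
      a +ₚ b            ≈⟨ +ₚ-cong (≃-refl {x = a}) (coeffwise b≈) ⟩
      a +ₚ (e +ₚ s)     ≡⟨ List.++-assoc a e s ⟨
      (a +ₚ e) +ₚ s     ∎

    h+s∈X : InQ X (h +ₚ s)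
    h+s∈X = InQ-cong f≃ f∈X

    h∈X : InQ X h
    h∈X = InQ-idealPart groebner h s h∈⟨Z⟩ (InCone-R-irreducible s s∈R) h+s∈X

    s∈X : InQ X s
    s∈X = InQ-+ₚ⁻ʳ h h+s∈X h∈X

theorem3p9 : (n : ℕ) (X : Subset n) (ord : MonomialOrder n)
  (Z P : List (Poly n))
  -- G : a Gröbner basis of ⟨Z⟩ ⊆ ℚ[Y] w.r.t. the elimination ordering ≼_X
  (G : List (Poly n)) → IsGroebner (elimRel ord X) Z G →
  -- GX = G ∩ ℚ[X]
  (GX : List (Poly n)) → (∀ g → (g ∈ GX) ⇔ (g ∈ G × InQ X g)) →
  -- R = { red_G(p) : p ∈ P }
  (R : List (Poly n)) → Pointwise (IsNormalForm (elimRel ord X) G) P R →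
  -- Q = proj(R, [X]) : cone(Q) = cone(R) ∩ span_ℚ [X]
  (Q : List (Poly n)) → (∀ f → InCone Q f ⇔ (InCone R f × InQ X f)) →
  -- alg.cone_X(project_X(Z,P)) = alg.cone_Y(Z,P) ∩ ℚ[X]
  ∀ f → InAlgCone X GX Q f ⇔ (InAlgCone ⊤ Z P f × InQ X f)
theorem3p9 n X ord Z P G groebner GX GX-spec R normalForms Q Q-spec f =
  mk⇔ (projection-sound f) (projection-complete f)
  where open Projection ord X groebner GX-spec normalForms Q-spec
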